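{- Let $\mathbf B$ be a finite MTL-chain, let $b\in B^+$, and let $v,w\in W^c$ be worlds of the canonical model of $\mathsf P_{\mathbf B}$. If $P^c_b(v,w)$ holds and $P^c_b(w,v)$ does not hold, then $P^{c<}_b(v,w)$ holds.
   Context: A finite MTL-chain is a finite linearly ordered bounded integral commutative residuated lattice $\mathbf{B}$; $B^+=B\setminus\{0\}$. Language $\mathbf{PFm}$: propositional variables, truth constants $\overline c$ ($c\in B$), connectives $\wedge,\vee,\odot,\to$, modalities $\Box_c$ ($c\in B$) and $\Box^<_c$ ($c\in B^+$); $\varphi\leftrightarrow\psi:=(\varphi\to\psi)\odot(\psi\to\varphi)$, $\Diamond_c\varphi:=\bigwedge_{a\in B}(\Box_c(\varphi\to\overline a)\to\overline a)$. $\mathsf P_{\mathbf B}$ is the Hilbert system consisting of: a sound and complete axiomatization of the propositional logic of $\mathbf B$ with constants (instances in $\mathbf{PFm}$, with modus ponens); for each modality $\Box\in\{\Box_c:c\in B\}\cup\{\Box^<_c:c\in B^+\}$ the axioms $\Box\overline1$, $(\Box\varphi\wedge\Box\psi)\to\Box(\varphi\wedge\psi)$, $\Box(\overline a\to\varphi)\leftrightarrow(\overline a\to\Box\varphi)$ ($a\in B$), $\Box(\overline k\vee\varphi)\to(\overline k\vee\Box\varphi)$ ($k$ the coatom), $\Box(\varphi\to\psi)\to(\Box\varphi\to\Box\psi)$, monotonicity and necessitation rules; $\Box_a\varphi\to\Box_c\varphi$ ($a\le c$ in $B$); $\Box_a\varphi\to\varphi$; $\Box_{a\wedge c}\varphi\to\Box_a\Box_c\varphi$;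 $\varphi\to\Box_0\Diamond_0\varphi$; $\Box^<_a\varphi\to\Box^<_c\varphi$ ($a\le c$ in $B^+$); $\Box^<_{a\wedge c}\varphi\to\Box^<_a\Box^<_c\varphi$ ($a,c\in B^+$); $\Box_c\varphi\to\Box^<_c\varphi$ ($c\in B^+$); for $a,c\in B^+$, $c\le a$: $\Box^<_c\varphi\to\Box_a\Box^<_c\varphi$ and $\Box^<_c\varphi\to\Box^<_c\Box_a\varphi$; for $c\in B^+,a\in B$: $(\Box^<_c\varphi\wedge(\psi\to\overline a))\to\Box_c(\varphi\vee(\Box_c\psi\to\overline a))$. Canonical model: $W^c$ is the set of maps $v:\mathbf{PFm}\to B$ that are homomorphisms for the connectives with $v(\overline c)=c$ and that send every theorem of $\mathsf P_{\mathbf B}$ to $1$; $P^c_c(v,w)$ iff for all $\varphi$, $v(\Box_c\varphi)=1$ implies $w(\varphi)=1$; $P^{c<}_c(v,w)$ iff for all $\varphi$, $v(\Box^<_c\varphi)=1$ implies $w(\varphi)=1$. -}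

module Defs where

open import Data.Nat using (ℕ)
open import Data.List using (List; []; _∷_)
open import Data.List.Membership.Propositional using (_∈_)
open import Data.Product using (_×_; _,_)
open import Relation.Nullary using (¬_)
open import Relation.Binary using (IsTotalOrder; Decidable)
open import Relation.Binary.PropositionalEquality using (_≡_; _≢_)
open import Function.Bundles using (_⇔_)

record MTLChain : Set₁ where
  infixr 9 _⊙_
  infixr 8 _⊓_
  infixr 7 _⊔_
  infixr 6 _⇒_
  infix 3 _≤_
  field
    Carrier : Set
    _≤_     : Carrier → Carrier → Set
    isTotalOrder : IsTotalOrder _≡_ _≤_
    _⊓_ _⊔_ _⊙_ _⇒_ : Carrier → Carrier → Carrier
    𝟘 𝟙 : Carrier
    ⊓-lowerˡ : ∀ x y → x ⊓ y ≤ x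
    ⊓-lowerʳ : ∀ x y → x ⊓ y ≤ y
    ⊓-glb    : ∀ x y z → z ≤ x → z ≤ y → z ≤ x ⊓ y
    ⊔-upperˡ : ∀ x y → x ≤ x ⊔ y
    ⊔-upperʳ : ∀ x y → y ≤ x ⊔ y
    ⊔-lub    : ∀ x y z → x ≤ z → y ≤ z → x ⊔ y ≤ z
    𝟘-min : ∀ x → 𝟘 ≤ x
    𝟙-max : ∀ x → x ≤ 𝟙
    ⊙-assoc : ∀ x y z → (x ⊙ y) ⊙ z ≡ x ⊙ (y ⊙ z)
    ⊙-comm  : ∀ x y → x ⊙ y ≡ y ⊙ x
    ⊙-identityʳ : ∀ x → x ⊙ 𝟙 ≡ x
    residuation : ∀ x y z → (x ⊙ y ≤ z) ⇔ (x ≤ y ⇒ z)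
    _≟_ : Decidable {A = Carrier} _≡_
    elems : List Carrier
    complete : ∀ x → x ∈ elems

  _<_ : Carrier → Carrier → Set
  x < y = (x ≤ y) × (x ≢ y)

  IsCoatom : Carrier → Set
  IsCoatom k = (k < 𝟙) × (∀ x → x < 𝟙 → x ≤ k)

module _ (𝐁 : MTLChain) where
  open MTLChain 𝐁

  data Fm : Set where
    pvar  : ℕ → Fm
    pcon  : Carrier → Fm
    _∧ᵖ_ _∨ᵖ_ _⊙ᵖ_ _⇒ᵖ_ : Fm → Fm → Fm

  evalᵖ : (ℕ → Carrier) → Fm → Carrier
  evalᵖ e (pvar n) = e n
  evalᵖ e (pcon c) = c
  evalᵖ e (φ ∧ᵖ ψ) = evalᵖ e φ ⊓ evalᵖ e ψ
  evalᵖ e (φ ∨ᵖ ψ) = evalᵖ e φ ⊔ evalᵖ e ψ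
  evalᵖ e (φ ⊙ᵖ ψ) = evalᵖ e φ ⊙ evalᵖ e ψ
  evalᵖ e (φ ⇒ᵖ ψ) = evalᵖ e φ ⇒ evalᵖ e ψ

  Valid : Fm → Set
  Valid ψ = ∀ (e : ℕ → Carrier) → evalᵖ e ψ ≡ 𝟙

  data Mod : Set where
    box   : Carrier → Mod
    boxlt : (c : Carrier) → .(c ≢ 𝟘) → Mod

  infixr 7 _⊙ᶠ_
  infixr 6 _∧ᶠ_
  infixr 5 _∨ᶠ_
  infixr 4 _⇒ᶠ_ _⇔ᶠ_

  data PFm : Set where
    var  : ℕ → PFm
    ‵_   : Carrier → PFm
    _∧ᶠ_ _∨ᶠ_ _⊙ᶠ_ _⇒ᶠ_ : PFm → PFm → PFm
    □[_]_ : Mod → PFm → PFm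

  _⇔ᶠ_ : PFm → PFm → PFm
  φ ⇔ᶠ ψ = (φ ⇒ᶠ ψ) ⊙ᶠ (ψ ⇒ᶠ φ)

  inst : (ℕ → PFm) → Fm → PFm
  inst σ (pvar n) = σ n
  inst σ (pcon c) = ‵ c
  inst σ (φ ∧ᵖ ψ) = inst σ φ ∧ᶠ inst σ ψ
  inst σ (φ ∨ᵖ ψ) = inst σ φ ∨ᶠ inst σ ψ
  inst σ (φ ⊙ᵖ ψ) = inst σ φ ⊙ᶠ inst σ ψ
  inst σ (φ ⇒ᵖ ψ) = inst σ φ ⇒ᶠ inst σ ψ

  ⋀ : List PFm → PFm
  ⋀ [] = ‵ 𝟙
  ⋀ (φ ∷ []) = φ
  ⋀ (φ ∷ ψ ∷ φs) = φ ∧ᶠ ⋀ (ψ ∷ φs)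

  mapL : (Carrier → PFm) → List Carrier → List PFm
  mapL f [] = []
  mapL f (x ∷ xs) = f x ∷ mapL f xs

  ◇ : Carrier → PFm → PFm
  ◇ c φ = ⋀ (mapL (λ a → (□[ box c ] (φ ⇒ᶠ ‵ a)) ⇒ᶠ ‵ a) elems)

  infix 2 ⊢_

  data ⊢_ : PFm → Set where
    taut : (ψ : Fm) → Valid ψ → (σ : ℕ → PFm) → ⊢ inst σ ψ
    mp   : ∀ {φ ψ} → ⊢ φ → ⊢ (φ ⇒ᶠ ψ) → ⊢ ψ
    ax-1    : ∀ m → ⊢ □[ m ] (‵ 𝟙)
    ax-∧    : ∀ m φ ψ → ⊢ ((□[ m ] φ) ∧ᶠ (□[ m ] ψ)) ⇒ᶠ □[ m ] (φ ∧ᶠ ψ)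
    ax-con  : ∀ m a φ → ⊢ (□[ m ] (‵ a ⇒ᶠ φ)) ⇔ᶠ (‵ a ⇒ᶠ □[ m ] φ)
    ax-coat : ∀ m k → IsCoatom k → ∀ φ → ⊢ (□[ m ] (‵ k ∨ᶠ φ)) ⇒ᶠ (‵ k ∨ᶠ □[ m ] φ)
    ax-K    : ∀ m φ ψ → ⊢ (□[ m ] (φ ⇒ᶠ ψ)) ⇒ᶠ ((□[ m ] φ) ⇒ᶠ □[ m ] ψ)
    rule-mono : ∀ m {φ ψ} → ⊢ (φ ⇒ᶠ ψ) → ⊢ (□[ m ] φ) ⇒ᶠ □[ m ] ψ
    rule-nec  : ∀ m {φ} → ⊢ φ → ⊢ □[ m ] φ
    ax-□mono : ∀ a c → a ≤ c → ∀ φ → ⊢ (□[ box a ] φ) ⇒ᶠ □[ box c ] φ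
    ax-T     : ∀ a φ → ⊢ (□[ box a ] φ) ⇒ᶠ φ
    ax-4     : ∀ a c φ → ⊢ (□[ box (a ⊓ c) ] φ) ⇒ᶠ □[ box a ] □[ box c ] φ
    ax-B     : ∀ φ → ⊢ φ ⇒ᶠ □[ box 𝟘 ] ◇ 𝟘 φ
    ax-□<mono : ∀ a c (pa : a ≢ 𝟘) (pc : c ≢ 𝟘) → a ≤ c → ∀ φ →
                ⊢ (□[ boxlt a pa ] φ) ⇒ᶠ □[ boxlt c pc ] φ
    ax-4<    : ∀ a c (pa : a ≢ 𝟘) (pc : c ≢ 𝟘) (pac : a ⊓ c ≢ 𝟘) → ∀ φ →
                ⊢ (□[ boxlt (a ⊓ c) pac ] φ) ⇒ᶠ □[ boxlt a pa ] □[ boxlt c pc ] φ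
    ax-□□<   : ∀ c (pc : c ≢ 𝟘) φ → ⊢ (□[ box c ] φ) ⇒ᶠ □[ boxlt c pc ] φ
    ax-<□1   : ∀ a c (pa : a ≢ 𝟘) (pc : c ≢ 𝟘) → c ≤ a → ∀ φ →
                ⊢ (□[ boxlt c pc ] φ) ⇒ᶠ □[ box a ] □[ boxlt c pc ] φ
    ax-<□2   : ∀ a c (pa : a ≢ 𝟘) (pc : c ≢ 𝟘) → c ≤ a → ∀ φ →
                ⊢ (□[ boxlt c pc ] φ) ⇒ᶠ □[ boxlt c pc ] □[ box a ] φ
    ax-mix   : ∀ c (pc : c ≢ 𝟘) a φ ψ →
                ⊢ ((□[ boxlt c pc ] φ) ∧ᶠ (ψ ⇒ᶠ ‵ a)) ⇒ᶠ
                  □[ box c ] (φ ∨ᶠ ((□[ box c ] ψ) ⇒ᶠ ‵ a))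

  record World : Set where
    field
      val   : PFm → Carrier
      val-∧ : ∀ φ ψ → val (φ ∧ᶠ ψ) ≡ val φ ⊓ val ψ
      val-∨ : ∀ φ ψ → val (φ ∨ᶠ ψ) ≡ val φ ⊔ val ψ
      val-⊙ : ∀ φ ψ → val (φ ⊙ᶠ ψ) ≡ val φ ⊙ val ψ
      val-⇒ : ∀ φ ψ → val (φ ⇒ᶠ ψ) ≡ val φ ⇒ val ψ
      val-‵ : ∀ c → val (‵ c) ≡ c
      val-thm : ∀ φ → ⊢ φ → val φ ≡ 𝟙
  open World public

  Pᶜ : Carrier → World → World → Set
  Pᶜ c v w = ∀ φ → val v (□[ box c ] φ) ≡ 𝟙 → val w φ ≡ 𝟙

  Pᶜ< : (c : Carrier) → .(c ≢ 𝟘) → World → World → Set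
  Pᶜ< c pc v w = ∀ φ → val v (□[ boxlt c pc ] φ) ≡ 𝟙 → val w φ ≡ 𝟙

module Submission where

-- Suppose P_b(v,w) and v ⊨ □<_b φ, but w ⊭ φ; we show P_b(w,v),
-- contradicting the hypothesis.  So let w ⊨ □_b ψ and suppose v ⊭ ψ, with
-- a := v(ψ) ≠ 1.  Then v ⊨ □<_b φ ∧ (ψ → a), so the mixing axiom gives
-- v ⊨ □_b (φ ∨ (□_b ψ → a)), hence w ⊨ φ ∨ (□_b ψ → a) by P_b(v,w).  In a
-- chain a join equals 1 only if one of the joinands does, and w ⊨ □_b ψ
-- excludes w ⊨ □_b ψ → a; thus w ⊨ φ, a contradiction.  Both "suppose
-- not" steps are legitimate because equality in a finite chain is decidable.

open import Defs
open import Data.Empty using (⊥-elim)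
open import Data.Sum using (_⊎_; inj₁; inj₂)
open import Function.Bundles using (Equivalence)
open import Relation.Binary using (IsTotalOrder)
open import Relation.Binary.PropositionalEquality using (_≡_; _≢_; sym; trans; subst)
open import Relation.Nullary using (¬_)
open import Relation.Nullary.Decidable using (decidable-stable)

module ChainFacts (𝐁 : MTLChain) where
  open MTLChain 𝐁
  open IsTotalOrder isTotalOrder using (antisym; total; reflexive) renaming (refl to ≤-refl)
  open Equivalence using (to; from)

  𝟙≤⇒≡𝟙 : ∀ {x} → 𝟙 ≤ x → x ≡ 𝟙
  𝟙≤⇒≡𝟙 = antisym (𝟙-max _)

  ⊙-identityˡ : ∀ x → 𝟙 ⊙ x ≡ x
  ⊙-identityˡ x = trans (⊙-comm 𝟙 x) (⊙-identityʳ x)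

  ⇒≡𝟙⇒≤ : ∀ {x y} → x ⇒ y ≡ 𝟙 → x ≤ y
  ⇒≡𝟙⇒≤ {x} {y} x⇒y≡𝟙 =
    subst (_≤ y) (⊙-identityˡ x) (from (residuation 𝟙 x y) (reflexive (sym x⇒y≡𝟙)))

  ≤⇒⇒≡𝟙 : ∀ {x y} → x ≤ y → x ⇒ y ≡ 𝟙
  ≤⇒⇒≡𝟙 {x} {y} x≤y =
    𝟙≤⇒≡𝟙 (to (residuation 𝟙 x y) (subst (_≤ y) (sym (⊙-identityˡ x)) x≤y))

  ⇒-refl : ∀ x → x ⇒ x ≡ 𝟙
  ⇒-refl x = ≤⇒⇒≡𝟙 ≤-refl

  ⇒-mp : ∀ {x y} → x ⇒ y ≡ 𝟙 → x ≡ 𝟙 → y ≡ 𝟙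
  ⇒-mp {y = y} x⇒y≡𝟙 x≡𝟙 = 𝟙≤⇒≡𝟙 (subst (_≤ y) x≡𝟙 (⇒≡𝟙⇒≤ x⇒y≡𝟙))

  ⊓-𝟙 : ∀ {x y} → x ≡ 𝟙 → y ≡ 𝟙 → x ⊓ y ≡ 𝟙
  ⊓-𝟙 {x} {y} x≡𝟙 y≡𝟙 = 𝟙≤⇒≡𝟙 (⊓-glb x y 𝟙 (reflexive (sym x≡𝟙)) (reflexive (sym y≡𝟙)))

  -- In a chain the join of two elements is one of them, so 1 is join-prime.
  ⊔-𝟙 : ∀ {x y} → x ⊔ y ≡ 𝟙 → x ≡ 𝟙 ⊎ y ≡ 𝟙
  ⊔-𝟙 {x} {y} x⊔y≡𝟙 with total x y
  ... | inj₁ x≤y = inj₂ (𝟙≤⇒≡𝟙 (subst (_≤ y) x⊔y≡𝟙 (⊔-lub x y y x≤y ≤-refl)))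
  ... | inj₂ y≤x = inj₁ (𝟙≤⇒≡𝟙 (subst (_≤ x) x⊔y≡𝟙 (⊔-lub x y x ≤-refl y≤x)))

module Truth (𝐁 : MTLChain) where
  open MTLChain 𝐁 using (𝟘; 𝟙; _⇒_; _≟_)
  open ChainFacts 𝐁

  infix 3 _⊨_
  _⊨_ : World 𝐁 → PFm 𝐁 → Set
  v ⊨ φ = val v φ ≡ 𝟙

  ⊨-stable : ∀ v φ → ¬ ¬ (v ⊨ φ) → v ⊨ φ
  ⊨-stable v φ = decidable-stable (val v φ ≟ 𝟙)

  ⊨-mp : ∀ v {φ ψ} → v ⊨ (φ ⇒ᶠ ψ) → v ⊨ φ → v ⊨ ψ
  ⊨-mp v {φ} {ψ} v⊨φ⇒ψ = ⇒-mp (trans (sym (val-⇒ v φ ψ)) v⊨φ⇒ψ)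

  ⊨-∧ : ∀ v {φ ψ} → v ⊨ φ → v ⊨ ψ → v ⊨ (φ ∧ᶠ ψ)
  ⊨-∧ v {φ} {ψ} v⊨φ v⊨ψ = trans (val-∧ v φ ψ) (⊓-𝟙 v⊨φ v⊨ψ)

  ⊨-∨ : ∀ v {φ ψ} → v ⊨ (φ ∨ᶠ ψ) → (v ⊨ φ) ⊎ (v ⊨ ψ)
  ⊨-∨ v {φ} {ψ} v⊨φ∨ψ = ⊔-𝟙 (trans (sym (val-∨ v φ ψ)) v⊨φ∨ψ)

  ⊨-‵ : ∀ v {a} → v ⊨ (‵ a) → a ≡ 𝟙
  ⊨-‵ v {a} v⊨a = trans (sym (val-‵ v a)) v⊨a

  ⊨-bounded-by-value : ∀ v ψ → v ⊨ (ψ ⇒ᶠ ‵ (val v ψ))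
  ⊨-bounded-by-value v ψ =
    trans (val-⇒ v ψ (‵ a)) (subst (λ c → a ⇒ c ≡ 𝟙) (sym (val-‵ v a)) (⇒-refl a))
    where a = val v ψ

  -- This is the content of the axiom
  -- (□<_c φ ∧ (ψ → a)) → □_c (φ ∨ (□_c ψ → a)) in the canonical model.
  mixing : ∀ b (pb : b ≢ 𝟘) (v w : World 𝐁) → Pᶜ 𝐁 b v w → ∀ φ ψ →
    v ⊨ □[ boxlt b pb ] φ → w ⊨ □[ box b ] ψ → ¬ (v ⊨ ψ) → w ⊨ φ
  mixing b pb v w Pvw φ ψ v⊨□<φ w⊨□ψ v⊭ψ with ⊨-∨ w (Pvw _ v⊨□[φ∨□ψ⇒a])
    where
      a = val v ψ
      v⊨□[φ∨□ψ⇒a] : v ⊨ □[ box b ] (φ ∨ᶠ ((□[ box b ] ψ) ⇒ᶠ ‵ a))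
      v⊨□[φ∨□ψ⇒a] = ⊨-mp v (val-thm v _ (ax-mix b pb a φ ψ))
                            (⊨-∧ v v⊨□<φ (⊨-bounded-by-value v ψ))
  ... | inj₁ w⊨φ = w⊨φ
  ... | inj₂ w⊨□ψ⇒a = ⊥-elim (v⊭ψ (⊨-‵ w (⊨-mp w w⊨□ψ⇒a w⊨□ψ)))

-- If w ⊭ φ although v ⊨ □<_b φ, the mixing lemma shows that every
-- □_b-necessity at w holds at v, i.e. P_b(w,v).
lemma5 : (𝐁 : MTLChain) (b : MTLChain.Carrier 𝐁) (pb : b ≢ MTLChain.𝟘 𝐁) (v w : World 𝐁) →
    Pᶜ 𝐁 b v w → ¬ Pᶜ 𝐁 b w v → Pᶜ< 𝐁 b pb v w
lemma5 𝐁 b pb v w Pvw ¬Pwv φ v⊨□<φ =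
  ⊨-stable w φ λ w⊭φ →
    ¬Pwv λ ψ w⊨□ψ →
      ⊨-stable v ψ λ v⊭ψ →
        w⊭φ (mixing b pb v w Pvw φ ψ v⊨□<φ w⊨□ψ v⊭ψ)
  where open Truth 𝐁
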